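{- Let $\Sigma$ be a many-typed signature, $\Gamma$ a context, $\tau$ a type, and $\Gamma\vdash t_0:\tau$, $\Gamma\vdash t_1:\tau$ terms. If $\Gamma\vdash\ \downarrow^{\mathrm{nf}}_\tau(\mathrm{nf}_{\Gamma,\tau}(t_0))=\ \downarrow^{\mathrm{nf}}_\tau(\mathrm{nf}_{\Gamma,\tau}(t_1)):\tau$, then $\Gamma\vdash t_0=t_1:\tau$.
   Context: A many-typed signature $\Sigma=(S,O)$ consists of a set $S$ of atomic types and operation symbols $\vartheta$ with arities $O(\vartheta)=(\Delta,\tau)$ ($\Delta$ a list of types, $\tau$ a type). Simple types are generated from $S$ by $\times,\to$; contexts are finite lists of types. Syntax: terms $\Gamma\vdash t:\tau$ and substitutions $\Gamma\vdash\delta:\Delta$ generated by the last variable $\mathrm{v}$, operations $\Delta\vdash\vartheta:\tau$, explicit substitution $t[\delta]$, $\lambda$, application, pairs, projections $t.1,t.2$, and substitutions $\mathrm{id}$, weakening $\mathrm{p}$, extension $(\delta,t)$, composition; quotiented by the congruence generated by $\beta\eta$ for functions and pairs, category laws, $\mathrm{p}\circ(\delta,t)=\delta$, $(\xi,t)\circ\delta=(\xi\circ\delta,t[\delta])$, $\mathrm{v}[(\delta,t)]=t$, $\mathrm{v}[\mathrm{id}]=\mathrm{v}$, and substitution commuting with term formers; "$\Gamma\vdash s=t:\tau$" denotes this definitional equality. $\mathrm{Cl}(\Sigma)$: contexts and equivalence classes of substitutions (the free $\lambda$-theory on $\Sigma$). $\mathrm{Ren}(\Sigma)$: contexts and type-preserving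 variable renamings, $i:\mathrm{Ren}(\Sigma)\to\mathrm{Cl}(\Sigma)$ the inclusion; $\mathrm{TM}(\Delta)=\mathrm{Hom}_{\mathrm{Cl}(\Sigma)}(i(-),\Delta)$, a presheaf on $\mathrm{Ren}(\Sigma)$. Neutrals: variables, $\vartheta[\delta]$ ($\delta$ normal substitution), $t(s)$ ($t$ neutral, $s$ normal), $t.1,t.2$; normals: neutrals at atomic type, $\lambda^\sigma.t$, pairs; substitutions are tuples. $\mathrm{NE}_\tau,\mathrm{NF}_\tau$ (and $\mathrm{NE}_\Gamma,\mathrm{NF}_\Gamma$ for contexts) are the presheaves of these unquotiented syntactic forms; $\downarrow^{\mathrm{ne}},\downarrow^{\mathrm{nf}}$ map them to their equivalence classes in $\mathrm{TM}$. $\mathrm{id}_\Gamma\in\mathrm{NE}_\Gamma(\Gamma)$ is the tuple of all variables of $\Gamma$. Presheaves $P_\tau$, maps $\mathrm{reflect}_\tau:\mathrm{NE}_\tau\to P_\tau$, $\mathrm{reify}_\tau:P_\tau\to\mathrm{NF}_\tau$: atomic $P_\tau=\mathrm{NF}_\tau$ (reflect = inclusion, reify = identity); $P_{\sigma\times\tau}=P_\sigma\times P_\tau$ componentwise; $P_{\sigma\to\tau}$ the pullback of $F\mapsto\lambda v.\downarrow^{\mathrm{nf}}\mathrm{reify}_\tau(Fv)$ and $t\mapsto\lambda v.t(\downarrow^{\mathrm{nf}}\mathrm{reify}_\sigma v)$ into $\mathrm{TM}(\tau)^{P_\sigma}$, elements pairs $(t,F)$, $\mathrm{reflect}(t)=(\downarrow^{\mathrm{ne}}t,\lambda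 v.\mathrm{reflect}_\tau(t(\mathrm{reify}_\sigma v)))$, $\mathrm{reify}(t,F)=\lambda^\sigma.\mathrm{reify}_\tau(F(\mathrm{reflect}_\sigma x))$, $x$ the fresh variable; contexts: $P_{[\,]}=1$, $P_{\Gamma,\tau}=P_\Gamma\times P_\tau$ componentwise. Gluing category $\mathrm{Gl}(\Sigma)=\mathrm{id}\downarrow\mathrm{TM}$: objects $(\mathcal D,\Delta,q:\mathcal D\to\mathrm{TM}(\Delta))$, morphisms pairs $(d,\delta)$ with $q_\Delta\circ d=\mathrm{TM}(\delta)\circ q_\Gamma$. It is cartesian closed with $[\![\tau]\!]=(P_\tau,\tau,\downarrow^{\mathrm{nf}}\circ\mathrm{reify}_\tau)$ (similarly for contexts) realizing products and exponentials; $[\![-]\!]:\mathrm{Cl}(\Sigma)\to\mathrm{Gl}(\Sigma)$ is the induced structure-preserving interpretation functor (each operation $\vartheta$ interpreted by a $\mathrm{Gl}$-morphism whose $\mathrm{Cl}$-component is $\vartheta$). The normalization function $\mathrm{nf}_{\Gamma,\Delta}:\mathrm{Hom}_{\mathrm{Cl}(\Sigma)}(\Gamma,\Delta)\to\mathrm{NF}_\Delta(\Gamma)$ is: given $\delta$, write $[\![\delta]\!]=(d,\delta')$ with $d:P_\Gamma\to P_\Delta$, and set $\mathrm{nf}_{\Gamma,\Delta}(\delta)=(\mathrm{reify}_\Delta)_\Gamma\big(d_\Gamma((\mathrm{reflect}_\Gamma)_\Gamma(\mathrm{id}_\Gamma))\big)$. -}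

module Defs where

open import Data.Product using (_×_; _,_; proj₁; proj₂)
open import Data.Unit using (⊤; tt)

infixr 6 _⇒_
infixr 7 _⊗_
infixl 5 _▸_

data Ty (S : Set) : Set where
  ι   : S → Ty S
  _⇒_ : Ty S → Ty S → Ty S
  _⊗_ : Ty S → Ty S → Ty S

-- contexts: finite (snoc) lists of types; the last entry is the last variable
data Con (S : Set) : Set where
  ∙   : Con S
  _▸_ : Con S → Ty S → Con S

record Signature : Set₁ where
  field
    Sort : Set
    Op   : Set
    ar   : Op → Con Sort × Ty Sort

  dom : Op → Con Sort
  dom ϑ = proj₁ (ar ϑ)

  cod : Op → Ty Sort
  cod ϑ = proj₂ (ar ϑ)

module Lang (Sig : Signature) where
  open Signature Sig public

  Type : Set
  Type = Ty Sort

  Ctx : Set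
  Ctx = Con Sort

  infixl 8 _[_]
  infixr 9 _∘_
  infixl 4 _,ₛ_
  infix 3 _≈_ _≈ₛ_

  data Tm : Ctx → Type → Set
  data Sub : Ctx → Ctx → Set

  data Tm where
    v     : ∀ {Γ τ} → Tm (Γ ▸ τ) τ
    op    : (ϑ : Op) → Tm (dom ϑ) (cod ϑ)
    _[_]  : ∀ {Γ Δ τ} → Tm Δ τ → Sub Γ Δ → Tm Γ τ
    lam   : ∀ {Γ σ τ} → Tm (Γ ▸ σ) τ → Tm Γ (σ ⇒ τ)
    app   : ∀ {Γ σ τ} → Tm Γ (σ ⇒ τ) → Tm Γ σ → Tm Γ τ
    pair  : ∀ {Γ σ τ} → Tm Γ σ → Tm Γ τ → Tm Γ (σ ⊗ τ)
    fst   : ∀ {Γ σ τ} → Tm Γ (σ ⊗ τ) → Tm Γ σ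
    snd   : ∀ {Γ σ τ} → Tm Γ (σ ⊗ τ) → Tm Γ τ

  data Sub where
    id    : ∀ {Γ} → Sub Γ Γ
    p     : ∀ {Γ τ} → Sub (Γ ▸ τ) Γ
    ε     : ∀ {Γ} → Sub Γ ∙
    _,ₛ_  : ∀ {Γ Δ τ} → Sub Γ Δ → Tm Γ τ → Sub Γ (Δ ▸ τ)
    _∘_   : ∀ {Γ Δ Θ} → Sub Δ Θ → Sub Γ Δ → Sub Γ Θ

  data _≈_ : ∀ {Γ τ} → Tm Γ τ → Tm Γ τ → Set
  data _≈ₛ_ : ∀ {Γ Δ} → Sub Γ Δ → Sub Γ Δ → Set

  data _≈_ where
    refl≈  : ∀ {Γ τ} {t : Tm Γ τ} → t ≈ t
    sym≈   : ∀ {Γ τ} {t u : Tm Γ τ} → t ≈ u → u ≈ t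
    trans≈ : ∀ {Γ τ} {t u w : Tm Γ τ} → t ≈ u → u ≈ w → t ≈ w
    [_]≈[_] : ∀ {Γ Δ τ} {t t' : Tm Δ τ} {δ δ' : Sub Γ Δ} →
              t ≈ t' → δ ≈ₛ δ' → t [ δ ] ≈ t' [ δ' ]
    lam≈   : ∀ {Γ σ τ} {t t' : Tm (Γ ▸ σ) τ} → t ≈ t' → lam t ≈ lam t'
    app≈   : ∀ {Γ σ τ} {t t' : Tm Γ (σ ⇒ τ)} {s s' : Tm Γ σ} →
             t ≈ t' → s ≈ s' → app t s ≈ app t' s'
    pair≈  : ∀ {Γ σ τ} {a a' : Tm Γ σ} {b b' : Tm Γ τ} →
             a ≈ a' → b ≈ b' → pair a b ≈ pair a' b'
    fst≈   : ∀ {Γ σ τ} {t t' : Tm Γ (σ ⊗ τ)} → t ≈ t' → fst t ≈ fst t'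
    snd≈   : ∀ {Γ σ τ} {t t' : Tm Γ (σ ⊗ τ)} → t ≈ t' → snd t ≈ snd t'
    ⇒β     : ∀ {Γ σ τ} {t : Tm (Γ ▸ σ) τ} {s : Tm Γ σ} →
             app (lam t) s ≈ t [ id ,ₛ s ]
    ⇒η     : ∀ {Γ σ τ} {t : Tm Γ (σ ⇒ τ)} → t ≈ lam (app (t [ p ]) v)
    ⊗β₁    : ∀ {Γ σ τ} {a : Tm Γ σ} {b : Tm Γ τ} → fst (pair a b) ≈ a
    ⊗β₂    : ∀ {Γ σ τ} {a : Tm Γ σ} {b : Tm Γ τ} → snd (pair a b) ≈ b
    ⊗η     : ∀ {Γ σ τ} {t : Tm Γ (σ ⊗ τ)} → t ≈ pair (fst t) (snd t)
    [id]   : ∀ {Γ τ} {t : Tm Γ τ} → t [ id ] ≈ t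
    [∘]    : ∀ {Γ Δ Θ τ} {t : Tm Θ τ} {δ : Sub Δ Θ} {ξ : Sub Γ Δ} →
             t [ δ ] [ ξ ] ≈ t [ δ ∘ ξ ]
    v[,]   : ∀ {Γ Δ τ} {δ : Sub Γ Δ} {t : Tm Γ τ} → v [ δ ,ₛ t ] ≈ t
    v[id]  : ∀ {Γ τ} → v {Γ} {τ} [ id ] ≈ v
    lam[]  : ∀ {Γ Δ σ τ} {t : Tm (Δ ▸ σ) τ} {δ : Sub Γ Δ} →
             lam t [ δ ] ≈ lam (t [ (δ ∘ p) ,ₛ v ])
    app[]  : ∀ {Γ Δ σ τ} {t : Tm Δ (σ ⇒ τ)} {s : Tm Δ σ} {δ : Sub Γ Δ} →
             app t s [ δ ] ≈ app (t [ δ ]) (s [ δ ])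
    pair[] : ∀ {Γ Δ σ τ} {a : Tm Δ σ} {b : Tm Δ τ} {δ : Sub Γ Δ} →
             pair a b [ δ ] ≈ pair (a [ δ ]) (b [ δ ])
    fst[]  : ∀ {Γ Δ σ τ} {t : Tm Δ (σ ⊗ τ)} {δ : Sub Γ Δ} →
             fst t [ δ ] ≈ fst (t [ δ ])
    snd[]  : ∀ {Γ Δ σ τ} {t : Tm Δ (σ ⊗ τ)} {δ : Sub Γ Δ} →
             snd t [ δ ] ≈ snd (t [ δ ])

  data _≈ₛ_ where
    refl≈ₛ  : ∀ {Γ Δ} {δ : Sub Γ Δ} → δ ≈ₛ δ
    sym≈ₛ   : ∀ {Γ Δ} {δ ξ : Sub Γ Δ} → δ ≈ₛ ξ → ξ ≈ₛ δ
    trans≈ₛ : ∀ {Γ Δ} {δ ξ ζ : Sub Γ Δ} → δ ≈ₛ ξ → ξ ≈ₛ ζ → δ ≈ₛ ζ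
    ,≈      : ∀ {Γ Δ τ} {δ δ' : Sub Γ Δ} {t t' : Tm Γ τ} →
              δ ≈ₛ δ' → t ≈ t' → (δ ,ₛ t) ≈ₛ (δ' ,ₛ t')
    ∘≈      : ∀ {Γ Δ Θ} {δ δ' : Sub Δ Θ} {ξ ξ' : Sub Γ Δ} →
              δ ≈ₛ δ' → ξ ≈ₛ ξ' → δ ∘ ξ ≈ₛ δ' ∘ ξ'
    idl     : ∀ {Γ Δ} {δ : Sub Γ Δ} → id ∘ δ ≈ₛ δ
    idr     : ∀ {Γ Δ} {δ : Sub Γ Δ} → δ ∘ id ≈ₛ δ
    ass     : ∀ {Γ Δ Θ Ξ} {δ : Sub Θ Ξ} {ξ : Sub Δ Θ} {ζ : Sub Γ Δ} →
              (δ ∘ ξ) ∘ ζ ≈ₛ δ ∘ (ξ ∘ ζ)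
    p∘,     : ∀ {Γ Δ τ} {δ : Sub Γ Δ} {t : Tm Γ τ} → p ∘ (δ ,ₛ t) ≈ₛ δ
    ,∘      : ∀ {Γ Δ Θ τ} {ξ : Sub Δ Θ} {t : Tm Δ τ} {δ : Sub Γ Δ} →
              (ξ ,ₛ t) ∘ δ ≈ₛ (ξ ∘ δ) ,ₛ (t [ δ ])
    ,η      : ∀ {Γ Δ τ} {δ : Sub Γ (Δ ▸ τ)} → δ ≈ₛ (p ∘ δ) ,ₛ (v [ δ ])
    εη      : ∀ {Γ} {δ : Sub Γ ∙} → δ ≈ₛ ε

  data Var : Ctx → Type → Set where
    vz : ∀ {Γ τ} → Var (Γ ▸ τ) τ
    vs : ∀ {Γ σ τ} → Var Γ τ → Var (Γ ▸ σ) τ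

  -- a renaming Δ → Γ sends each variable of Γ to a variable of Δ of the same type
  Ren : Ctx → Ctx → Set
  Ren Δ Γ = ∀ {τ} → Var Γ τ → Var Δ τ

  idR : ∀ {Γ} → Ren Γ Γ
  idR x = x

  wkR : ∀ {Γ σ} → Ren (Γ ▸ σ) Γ
  wkR = vs

  liftR : ∀ {Γ Δ σ} → Ren Δ Γ → Ren (Δ ▸ σ) (Γ ▸ σ)
  liftR ρ vz     = vz
  liftR ρ (vs x) = vs (ρ x)

  data Ne : Ctx → Type → Set
  data Nf : Ctx → Type → Set
  data NfS : Ctx → Ctx → Set

  data Ne where
    var  : ∀ {Γ τ} → Var Γ τ → Ne Γ τ
    op   : ∀ {Γ} (ϑ : Op) → NfS Γ (dom ϑ) → Ne Γ (cod ϑ)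
    app  : ∀ {Γ σ τ} → Ne Γ (σ ⇒ τ) → Nf Γ σ → Ne Γ τ
    fst  : ∀ {Γ σ τ} → Ne Γ (σ ⊗ τ) → Ne Γ σ
    snd  : ∀ {Γ σ τ} → Ne Γ (σ ⊗ τ) → Ne Γ τ

  data Nf where
    ne   : ∀ {Γ a} → Ne Γ (ι a) → Nf Γ (ι a)
    lam  : ∀ {Γ σ τ} → Nf (Γ ▸ σ) τ → Nf Γ (σ ⇒ τ)
    pair : ∀ {Γ σ τ} → Nf Γ σ → Nf Γ τ → Nf Γ (σ ⊗ τ)

  data NfS where
    []  : ∀ {Γ} → NfS Γ ∙
    _,_ : ∀ {Γ Δ τ} → NfS Γ Δ → Nf Γ τ → NfS Γ (Δ ▸ τ)

  data NeS : Ctx → Ctx → Set where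
    []  : ∀ {Γ} → NeS Γ ∙
    _,_ : ∀ {Γ Δ τ} → NeS Γ Δ → Ne Γ τ → NeS Γ (Δ ▸ τ)

  renNe  : ∀ {Γ Δ τ} → Ren Δ Γ → Ne Γ τ → Ne Δ τ
  renNf  : ∀ {Γ Δ τ} → Ren Δ Γ → Nf Γ τ → Nf Δ τ
  renNfS : ∀ {Γ Δ Θ} → Ren Δ Γ → NfS Γ Θ → NfS Δ Θ

  renNe ρ (var x)   = var (ρ x)
  renNe ρ (op ϑ δ)  = op ϑ (renNfS ρ δ)
  renNe ρ (app n s) = app (renNe ρ n) (renNf ρ s)
  renNe ρ (fst n)   = fst (renNe ρ n)
  renNe ρ (snd n)   = snd (renNe ρ n)

  renNf ρ (ne n)     = ne (renNe ρ n)
  renNf ρ (lam t)    = lam (renNf (liftR ρ) t)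
  renNf ρ (pair a b) = pair (renNf ρ a) (renNf ρ b)

  renNfS ρ []      = []
  renNfS ρ (δ , t) = renNfS ρ δ , renNf ρ t

  wkNeS : ∀ {Γ Δ σ} → NeS Γ Δ → NeS (Γ ▸ σ) Δ
  wkNeS []      = []
  wkNeS (δ , n) = wkNeS δ , renNe wkR n

  idNe : ∀ {Γ} → NeS Γ Γ
  idNe {∙}     = []
  idNe {Γ ▸ τ} = wkNeS idNe , var vz

  ⌜_⌝v  : ∀ {Γ τ} → Var Γ τ → Tm Γ τ
  ⌜ vz ⌝v   = v
  ⌜ vs x ⌝v = ⌜ x ⌝v [ p ]

  ↓ne  : ∀ {Γ τ} → Ne Γ τ → Tm Γ τ
  ↓nf  : ∀ {Γ τ} → Nf Γ τ → Tm Γ τ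
  ↓nfS : ∀ {Γ Δ} → NfS Γ Δ → Sub Γ Δ

  ↓ne (var x)   = ⌜ x ⌝v
  ↓ne (op ϑ δ)  = op ϑ [ ↓nfS δ ]
  ↓ne (app n s) = app (↓ne n) (↓nf s)
  ↓ne (fst n)   = fst (↓ne n)
  ↓ne (snd n)   = snd (↓ne n)

  ↓nf (ne n)     = ↓ne n
  ↓nf (lam t)    = lam (↓nf t)
  ↓nf (pair a b) = pair (↓nf a) (↓nf b)

  ↓nfS []      = ε
  ↓nfS (δ , t) = ↓nfS δ ,ₛ ↓nf t

  -- The presheaves P_τ (computational part of the glued interpretation)

  P : Type → Ctx → Set
  P (ι a)   Γ = Nf Γ (ι a)
  P (σ ⇒ τ) Γ = ∀ {Δ} → Ren Δ Γ → P σ Δ → P τ Δ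
  P (σ ⊗ τ) Γ = P σ Γ × P τ Γ

  PC : Ctx → Ctx → Set
  PC ∙       Γ = ⊤
  PC (Δ ▸ τ) Γ = PC Δ Γ × P τ Γ

  renP : ∀ τ {Γ Δ} → Ren Δ Γ → P τ Γ → P τ Δ
  renP (ι a)   ρ x       = renNf ρ x
  renP (σ ⇒ τ) ρ f       = λ ρ' x → f (λ y → ρ' (ρ y)) x
  renP (σ ⊗ τ) ρ (a , b) = renP σ ρ a , renP τ ρ b

  renPC : ∀ Δ {Γ Γ'} → Ren Γ' Γ → PC Δ Γ → PC Δ Γ'
  renPC ∙       ρ e       = tt
  renPC (Δ ▸ τ) ρ (e , x) = renPC Δ ρ e , renP τ ρ x

  reflect : ∀ τ {Γ} → Ne Γ τ → P τ Γ
  reify   : ∀ τ {Γ} → P τ Γ → Nf Γ τ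

  reflect (ι a)   n = ne n
  reflect (σ ⇒ τ) n = λ ρ x → reflect τ (app (renNe ρ n) (reify σ x))
  reflect (σ ⊗ τ) n = reflect σ (fst n) , reflect τ (snd n)

  reify (ι a)   x       = x
  reify (σ ⇒ τ) f       = lam (reify τ (f wkR (reflect σ (var vz))))
  reify (σ ⊗ τ) (a , b) = pair (reify σ a) (reify τ b)

  reflectC : ∀ {Γ Δ} → NeS Γ Δ → PC Δ Γ
  reflectC []      = tt
  reflectC {Δ = Δ ▸ τ} (δ , n) = reflectC δ , reflect τ n

  reifyC : ∀ Δ {Γ} → PC Δ Γ → NfS Γ Δ
  reifyC ∙       e       = []
  reifyC (Δ ▸ τ) (e , x) = reifyC Δ e , reify τ x

  eval  : ∀ {Γ Δ τ} → Tm Δ τ → PC Δ Γ → P τ Γ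
  evalS : ∀ {Γ Δ Θ} → Sub Δ Θ → PC Δ Γ → PC Θ Γ

  eval v          (e , x) = x
  eval (op ϑ)     e       = reflect (cod ϑ) (op ϑ (reifyC (dom ϑ) e))
  eval (t [ δ ])  e       = eval t (evalS δ e)
  eval {Δ = Δ} (lam t) e  = λ ρ x → eval t (renPC Δ ρ e , x)
  eval (app t s)  e       = eval t e idR (eval s e)
  eval (pair a b) e       = eval a e , eval b e
  eval (fst t)    e       = proj₁ (eval t e)
  eval (snd t)    e       = proj₂ (eval t e)

  evalS id       e       = e
  evalS p        (e , x) = e
  evalS ε        e       = tt
  evalS (δ ,ₛ t) e       = evalS δ e , eval t e
  evalS (δ ∘ ξ)  e       = evalS δ (evalS ξ e)

  nfS : ∀ {Γ Δ} → Sub Γ Δ → NfS Γ Δ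
  nfS {Γ} {Δ} δ = reifyC Δ (evalS δ (reflectC (idNe {Γ})))

  nf : ∀ {Γ τ} → Tm Γ τ → Nf Γ τ
  nf {Γ} {τ} t = reify τ (eval t (reflectC (idNe {Γ})))

module Submission where

open import Defs
open import Data.Product using (_×_; _,_; proj₁; proj₂)
open import Data.Unit using (⊤; tt)
open import Relation.Binary.Bundles using (Setoid)
import Relation.Binary.Reasoning.Setoid as SetoidReasoning

-- Soundness of nf is proved with a Kripke logical relation, indexed by renamings, between terms
-- and semantic values.  A term is related to a value at base type when it is convertible to the
-- value's normal form, and at function type when it sends related arguments (in any renamed
-- context) to related results.  Reflection and reification respect the relation, and every term
-- is related to its evaluation in any related environment.  Since the variables idNe are related
-- to their reflection, t ≈ ↓nf (nf t), and the theorem follows by transitivity.  The relation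
-- supplies the Tm-component of the paper's glued presheaf P_{σ→τ}, which P in Defs omits.

module Soundness (Sig : Signature) where
  open Lang Sig

  infixr 2 _⟫_ _⟫ₛ_

  _⟫_ : ∀ {Γ τ} {t u w : Tm Γ τ} → t ≈ u → u ≈ w → t ≈ w
  _⟫_ = trans≈

  _⟫ₛ_ : ∀ {Γ Δ} {δ ξ ζ : Sub Γ Δ} → δ ≈ₛ ξ → ξ ≈ₛ ζ → δ ≈ₛ ζ
  _⟫ₛ_ = trans≈ₛ

  Tm-setoid : Ctx → Type → Setoid _ _
  Tm-setoid Γ τ = record
    { Carrier       = Tm Γ τ
    ; _≈_           = _≈_
    ; isEquivalence = record { refl = refl≈ ; sym = sym≈ ; trans = trans≈ }
    }

  subst-β : ∀ {Γ Δ σ τ} (t : Tm (Δ ▸ σ) τ) (δ : Sub Γ Δ) (s : Tm Γ σ) →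
            app (lam t [ δ ]) s ≈ t [ δ ,ₛ s ]
  subst-β t δ s = begin
    app (lam t [ δ ]) s                         ≈⟨ app≈ lam[] refl≈ ⟩
    app (lam (t [ (δ ∘ p) ,ₛ v ])) s            ≈⟨ ⇒β ⟩
    t [ (δ ∘ p) ,ₛ v ] [ id ,ₛ s ]              ≈⟨ [∘] ⟩
    t [ ((δ ∘ p) ,ₛ v) ∘ (id ,ₛ s) ]            ≈⟨ [ refl≈ ]≈[ ,∘ ] ⟩
    t [ ((δ ∘ p) ∘ (id ,ₛ s)) ,ₛ v [ id ,ₛ s ] ] ≈⟨ [ refl≈ ]≈[ ,≈ (ass ⟫ₛ ∘≈ refl≈ₛ p∘, ⟫ₛ idr) v[,] ] ⟩
    t [ δ ,ₛ s ]                                ∎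
    where open SetoidReasoning (Tm-setoid _ _)

  ⌜_⌝ʳ : ∀ {Γ Δ} → Ren Δ Γ → Sub Δ Γ
  ⌜_⌝ʳ {∙}     ρ = ε
  ⌜_⌝ʳ {Γ ▸ τ} ρ = ⌜ (λ x → ρ (vs x)) ⌝ʳ ,ₛ ⌜ ρ vz ⌝v

  ⌜⌝v-ren : ∀ {Γ Δ τ} (x : Var Γ τ) (ρ : Ren Δ Γ) → ⌜ x ⌝v [ ⌜ ρ ⌝ʳ ] ≈ ⌜ ρ x ⌝v
  ⌜⌝v-ren vz     ρ = v[,]
  ⌜⌝v-ren (vs x) ρ = [∘] ⟫ [ refl≈ ]≈[ p∘, ] ⟫ ⌜⌝v-ren x (λ y → ρ (vs y))

  ⌜⌝ʳ-∘ : ∀ {Γ Δ Θ} (ρ : Ren Δ Γ) (ρ' : Ren Θ Δ) → ⌜ ρ ⌝ʳ ∘ ⌜ ρ' ⌝ʳ ≈ₛ ⌜ (λ x → ρ' (ρ x)) ⌝ʳ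
  ⌜⌝ʳ-∘ {∙}     ρ ρ' = εη
  ⌜⌝ʳ-∘ {Γ ▸ τ} ρ ρ' = ,∘ ⟫ₛ ,≈ (⌜⌝ʳ-∘ (λ x → ρ (vs x)) ρ') (⌜⌝v-ren (ρ vz) ρ')

  ⌜⌝ʳ-vs : ∀ {Γ Δ σ} (ρ : Ren Δ Γ) → ⌜ (λ x → vs {σ = σ} (ρ x)) ⌝ʳ ≈ₛ ⌜ ρ ⌝ʳ ∘ p
  ⌜⌝ʳ-vs {∙}     ρ = sym≈ₛ εη
  ⌜⌝ʳ-vs {Γ ▸ τ} ρ = ,≈ (⌜⌝ʳ-vs (λ x → ρ (vs x))) refl≈ ⟫ₛ sym≈ₛ ,∘

  ⌜idR⌝ʳ : ∀ {Γ} → ⌜ idR {Γ} ⌝ʳ ≈ₛ id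
  ⌜idR⌝ʳ {∙}     = sym≈ₛ εη
  ⌜idR⌝ʳ {Γ ▸ τ} = ,≈ (⌜⌝ʳ-vs idR ⟫ₛ ∘≈ ⌜idR⌝ʳ refl≈ₛ ⟫ₛ idl ⟫ₛ sym≈ₛ idr) (sym≈ v[id]) ⟫ₛ sym≈ₛ ,η

  ⌜wkR⌝ʳ : ∀ {Γ σ} → ⌜ wkR {Γ} {σ} ⌝ʳ ≈ₛ p
  ⌜wkR⌝ʳ = ⌜⌝ʳ-vs idR ⟫ₛ ∘≈ ⌜idR⌝ʳ refl≈ₛ ⟫ₛ idl

  ↓ne-renNe  : ∀ {Γ Δ τ} (ρ : Ren Δ Γ) (n : Ne Γ τ) → ↓ne (renNe ρ n) ≈ ↓ne n [ ⌜ ρ ⌝ʳ ]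
  ↓nf-renNf  : ∀ {Γ Δ τ} (ρ : Ren Δ Γ) (n : Nf Γ τ) → ↓nf (renNf ρ n) ≈ ↓nf n [ ⌜ ρ ⌝ʳ ]
  ↓nfS-renNfS : ∀ {Γ Δ Θ} (ρ : Ren Δ Γ) (δ : NfS Γ Θ) → ↓nfS (renNfS ρ δ) ≈ₛ ↓nfS δ ∘ ⌜ ρ ⌝ʳ

  ↓ne-renNe ρ (var x)   = sym≈ (⌜⌝v-ren x ρ)
  ↓ne-renNe ρ (op ϑ δ)  = [ refl≈ ]≈[ ↓nfS-renNfS ρ δ ] ⟫ sym≈ [∘]
  ↓ne-renNe ρ (app n s) = app≈ (↓ne-renNe ρ n) (↓nf-renNf ρ s) ⟫ sym≈ app[]
  ↓ne-renNe ρ (fst n)   = fst≈ (↓ne-renNe ρ n) ⟫ sym≈ fst[]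
  ↓ne-renNe ρ (snd n)   = snd≈ (↓ne-renNe ρ n) ⟫ sym≈ snd[]

  ↓nf-renNf ρ (ne n)     = ↓ne-renNe ρ n
  ↓nf-renNf ρ (lam t)    = lam≈ (↓nf-renNf (liftR ρ) t ⟫ [ refl≈ ]≈[ ,≈ (⌜⌝ʳ-vs ρ) refl≈ ]) ⟫ sym≈ lam[]
  ↓nf-renNf ρ (pair a b) = pair≈ (↓nf-renNf ρ a) (↓nf-renNf ρ b) ⟫ sym≈ pair[]

  ↓nfS-renNfS ρ []      = sym≈ₛ εη
  ↓nfS-renNfS ρ (δ , t) = ,≈ (↓nfS-renNfS ρ δ) (↓nf-renNf ρ t) ⟫ₛ sym≈ₛ ,∘

  Rel : ∀ τ {Γ} → Tm Γ τ → P τ Γ → Set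
  Rel (ι a)   t x = t ≈ ↓nf x
  Rel (σ ⇒ τ) {Γ} t f =
    ∀ {Δ} (ρ : Ren Δ Γ) (s : Tm Δ σ) (x : P σ Δ) → Rel σ s x → Rel τ (app (t [ ⌜ ρ ⌝ʳ ]) s) (f ρ x)
  Rel (σ ⊗ τ) t x = Rel σ (fst t) (proj₁ x) × Rel τ (snd t) (proj₂ x)

  Rel-resp-≈ : ∀ τ {Γ} {t t' : Tm Γ τ} {x : P τ Γ} → Rel τ t x → t ≈ t' → Rel τ t' x
  Rel-resp-≈ (ι a)   r       e = sym≈ e ⟫ r
  Rel-resp-≈ (σ ⇒ τ) r       e ρ s x rx = Rel-resp-≈ τ (r ρ s x rx) (app≈ [ e ]≈[ refl≈ₛ ] refl≈)
  Rel-resp-≈ (σ ⊗ τ) (r , q) e = Rel-resp-≈ σ r (fst≈ e) , Rel-resp-≈ τ q (snd≈ e)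

  Rel-ren : ∀ τ {Γ Δ} {t : Tm Γ τ} {x : P τ Γ} (ρ : Ren Δ Γ) →
            Rel τ t x → Rel τ (t [ ⌜ ρ ⌝ʳ ]) (renP τ ρ x)
  Rel-ren (ι a) {x = x} ρ r = [ r ]≈[ refl≈ₛ ] ⟫ sym≈ (↓nf-renNf ρ x)
  Rel-ren (σ ⇒ τ) ρ r ρ' s x rx =
    Rel-resp-≈ τ (r (λ y → ρ' (ρ y)) s x rx) (app≈ ([ refl≈ ]≈[ sym≈ₛ (⌜⌝ʳ-∘ ρ ρ') ] ⟫ sym≈ [∘]) refl≈)
  Rel-ren (σ ⊗ τ) ρ (r , q) = Rel-resp-≈ σ (Rel-ren σ ρ r) fst[] , Rel-resp-≈ τ (Rel-ren τ ρ q) snd[]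

  Rel-reflect : ∀ τ {Γ} (n : Ne Γ τ) → Rel τ (↓ne n) (reflect τ n)
  Rel⇒≈reify  : ∀ τ {Γ} {t : Tm Γ τ} {x : P τ Γ} → Rel τ t x → t ≈ ↓nf (reify τ x)

  Rel-reflect (ι a)   n = refl≈
  Rel-reflect (σ ⇒ τ) n ρ s x rx =
    Rel-resp-≈ τ (Rel-reflect τ (app (renNe ρ n) (reify σ x)))
                 (app≈ (↓ne-renNe ρ n) (sym≈ (Rel⇒≈reify σ rx)))
  Rel-reflect (σ ⊗ τ) n = Rel-reflect σ (fst n) , Rel-reflect τ (snd n)

  Rel⇒≈reify (ι a)   r = r
  Rel⇒≈reify (σ ⇒ τ) r =
    ⇒η ⟫ lam≈ (app≈ [ refl≈ ]≈[ sym≈ₛ ⌜wkR⌝ʳ ] refl≈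
              ⟫ Rel⇒≈reify τ (r wkR v (reflect σ (var vz)) (Rel-reflect σ (var vz))))
  Rel⇒≈reify (σ ⊗ τ) (r , q) = ⊗η ⟫ pair≈ (Rel⇒≈reify σ r) (Rel⇒≈reify τ q)

  RelC : ∀ Δ {Γ} → Sub Γ Δ → PC Δ Γ → Set
  RelC ∙       δ e       = ⊤
  RelC (Δ ▸ τ) δ (e , x) = RelC Δ (p ∘ δ) e × Rel τ (v [ δ ]) x

  RelC-resp-≈ₛ : ∀ Δ {Γ} {δ δ' : Sub Γ Δ} {e : PC Δ Γ} → RelC Δ δ e → δ ≈ₛ δ' → RelC Δ δ' e
  RelC-resp-≈ₛ ∙       r       e = tt
  RelC-resp-≈ₛ (Δ ▸ τ) (r , q) e = RelC-resp-≈ₛ Δ r (∘≈ refl≈ₛ e) , Rel-resp-≈ τ q [ refl≈ ]≈[ e ]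

  RelC-ren : ∀ Δ {Γ Γ'} {δ : Sub Γ Δ} {e : PC Δ Γ} (ρ : Ren Γ' Γ) →
             RelC Δ δ e → RelC Δ (δ ∘ ⌜ ρ ⌝ʳ) (renPC Δ ρ e)
  RelC-ren ∙       ρ r       = tt
  RelC-ren (Δ ▸ τ) ρ (r , q) = RelC-resp-≈ₛ Δ (RelC-ren Δ ρ r) ass , Rel-resp-≈ τ (Rel-ren τ ρ q) [∘]

  RelC⇒≈reifyC : ∀ Δ {Γ} {δ : Sub Γ Δ} {e : PC Δ Γ} → RelC Δ δ e → δ ≈ₛ ↓nfS (reifyC Δ e)
  RelC⇒≈reifyC ∙       r       = εη
  RelC⇒≈reifyC (Δ ▸ τ) (r , q) = ,η ⟫ₛ ,≈ (RelC⇒≈reifyC Δ r) (Rel⇒≈reify τ q)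

  fundamental  : ∀ {Γ Δ τ} (t : Tm Δ τ) {δ : Sub Γ Δ} {e : PC Δ Γ} →
                 RelC Δ δ e → Rel τ (t [ δ ]) (eval t e)
  fundamentalS : ∀ {Γ Δ Θ} (ξ : Sub Δ Θ) {δ : Sub Γ Δ} {e : PC Δ Γ} →
                 RelC Δ δ e → RelC Θ (ξ ∘ δ) (evalS ξ e)

  fundamental v (r , q) = q
  fundamental (op ϑ) {e = e} r =
    Rel-resp-≈ (cod ϑ) (Rel-reflect (cod ϑ) (op ϑ (reifyC (dom ϑ) e)))
                       [ refl≈ ]≈[ sym≈ₛ (RelC⇒≈reifyC (dom ϑ) r) ]
  fundamental (t [ ξ ]) r = Rel-resp-≈ _ (fundamental t (fundamentalS ξ r)) (sym≈ [∘])
  fundamental {Δ = Δ} {τ = σ ⇒ τ} (lam t) {δ} r ρ s x rx =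
    Rel-resp-≈ τ (fundamental t (RelC-resp-≈ₛ Δ (RelC-ren Δ ρ r) (sym≈ₛ p∘,) , Rel-resp-≈ σ rx (sym≈ v[,])))
                 (sym≈ (app≈ [∘] refl≈ ⟫ subst-β t (δ ∘ ⌜ ρ ⌝ʳ) s))
  fundamental (app t s) r =
    Rel-resp-≈ _ (fundamental t r idR _ _ (fundamental s r))
                 (app≈ ([ refl≈ ]≈[ ⌜idR⌝ʳ ] ⟫ [id]) refl≈ ⟫ sym≈ app[])
  fundamental (pair a b) r =
    Rel-resp-≈ _ (fundamental a r) (sym≈ ⊗β₁ ⟫ fst≈ (sym≈ pair[])) ,
    Rel-resp-≈ _ (fundamental b r) (sym≈ ⊗β₂ ⟫ snd≈ (sym≈ pair[]))
  fundamental (fst t) r = Rel-resp-≈ _ (proj₁ (fundamental t r)) (sym≈ fst[])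
  fundamental (snd t) r = Rel-resp-≈ _ (proj₂ (fundamental t r)) (sym≈ snd[])

  fundamentalS id      r       = RelC-resp-≈ₛ _ r (sym≈ₛ idl)
  fundamentalS p       (r , q) = r
  fundamentalS ε       r       = tt
  fundamentalS (ξ ,ₛ t) r      =
    RelC-resp-≈ₛ _ (fundamentalS ξ r) (sym≈ₛ (sym≈ₛ ass ⟫ₛ ∘≈ p∘, refl≈ₛ)) ,
    Rel-resp-≈ _ (fundamental t r) (sym≈ ([ refl≈ ]≈[ ,∘ ] ⟫ v[,]))
  fundamentalS (ξ ∘ ζ) r       = RelC-resp-≈ₛ _ (fundamentalS ξ (fundamentalS ζ r)) (sym≈ₛ ass)

  ↓neS : ∀ {Γ Δ} → NeS Γ Δ → Sub Γ Δ
  ↓neS []      = ε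
  ↓neS (δ , n) = ↓neS δ ,ₛ ↓ne n

  RelC-reflectC : ∀ {Γ Δ} (δ : NeS Γ Δ) → RelC Δ (↓neS δ) (reflectC δ)
  RelC-reflectC []                  = tt
  RelC-reflectC {Δ = Δ ▸ τ} (δ , n) =
    RelC-resp-≈ₛ Δ (RelC-reflectC δ) (sym≈ₛ p∘,) , Rel-resp-≈ τ (Rel-reflect τ n) (sym≈ v[,])

  ↓neS-wkNeS : ∀ {Γ Δ σ} (δ : NeS Γ Δ) → ↓neS (wkNeS {σ = σ} δ) ≈ₛ ↓neS δ ∘ p
  ↓neS-wkNeS []      = sym≈ₛ εη
  ↓neS-wkNeS (δ , n) = ,≈ (↓neS-wkNeS δ) (↓ne-renNe wkR n ⟫ [ refl≈ ]≈[ ⌜wkR⌝ʳ ]) ⟫ₛ sym≈ₛ ,∘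

  ↓neS-idNe : ∀ {Γ} → ↓neS (idNe {Γ}) ≈ₛ id
  ↓neS-idNe {∙}     = sym≈ₛ εη
  ↓neS-idNe {Γ ▸ τ} = ,≈ (↓neS-wkNeS idNe ⟫ₛ ∘≈ ↓neS-idNe refl≈ₛ ⟫ₛ idl ⟫ₛ sym≈ₛ idr) (sym≈ v[id]) ⟫ₛ sym≈ₛ ,η

  nf-sound : ∀ {Γ τ} (t : Tm Γ τ) → t ≈ ↓nf (nf t)
  nf-sound {Γ} {τ} t =
    sym≈ [id] ⟫ Rel⇒≈reify τ (fundamental t (RelC-resp-≈ₛ Γ (RelC-reflectC idNe) ↓neS-idNe))

mainTheorem5 : (Sig : Signature) → let open Lang Sig in
    ∀ (Γ : Ctx) (τ : Type) (t₀ t₁ : Tm Γ τ) →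
    ↓nf (nf t₀) ≈ ↓nf (nf t₁) → t₀ ≈ t₁
mainTheorem5 Sig Γ τ t₀ t₁ nf₀≈nf₁ = nf-sound t₀ ⟫ nf₀≈nf₁ ⟫ sym≈ (nf-sound t₁)
  where open Lang Sig
        open Soundness Sig
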